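{- Let $G$ be a connected graph (no loops, no multiple edges), $b\in V_G$, $\ell\in\mathbb{Z}_{\ge0}$, $\mathbf{q}$ a $G$-path starting at $b$, and $(\mathbf{p},L)\in\operatorname{Tab}^{\preceq\mathbf{q}}_{G,b,\ell}$. Then $(\mathbf{p},L)$ is a tight $(G,b,\ell)$-tableau if and only if $g^{\mathbf{q}}((\mathbf{p},L))$ is join-irreducible in the lattice $\operatorname{Tab}^{\mathbf{q},\infty}_{G,b,\ell}$.
   Context: A $G$-path $\mathbf{p}$ has length $\#\mathbf{p}$, edges $\mathbf{p}_i=\{p_{i-1},p_i\}\in E_G$ and vertices $p_0,\dots,p_{\#\mathbf{p}}$; $\mathbf{p}\preceq^{\mathrm{pre}}\mathbf{q}$ means $\mathbf{p}$ is a prefix (initial segment) of $\mathbf{q}$; a path is cycle-free if its vertices are distinct. For $\#\mathbf{p}>0$ write $\mathbf{p}=\mathbf{p}^{(1)}\cdots\mathbf{p}^{(n_{\mathbf{p}})}$ for the unique factorization into positive-length paths with each $\mathbf{p}^{(t)}$ the longest cycle-free suffix of $\mathbf{p}^{(1)}\cdots\mathbf{p}^{(t)}$, and $d_{\mathbf{p}}(r)$ for the index of the block containing the $r$-th edge. A $(G,b,\ell)$-tableau is $(\mathbf{p},L)$, $\mathbf{p}$ a $G$-path with $p_0=b$, $L:[1,\#\mathbf{p}]\to\mathbb{Z}_{\ge0}$ with (i) $L$ weakly increasing, (ii) $i<j$, $p_{i-1}=p_j$ imply $L(i)<L(j)$, (iii) $L(\#\mathbf{p})+\#\mathbf{p}\le\ell$.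 $\operatorname{Tab}^{\preceq\mathbf{q}}_{G,b,\ell}$ is the set of such tableaux with $\mathbf{p}\preceq^{\mathrm{pre}}\mathbf{q}$. A tableau is tight if it equals $(\mathbf{p},L_{\langle\mathbf{p},a\rangle})$ with $L_{\langle\mathbf{p},a\rangle}(r)=d_{\mathbf{p}}(r)+a-1$ for some $\#\mathbf{p}>0$ and integer $0\le a\le\ell+1-\#\mathbf{p}-n_{\mathbf{p}}$. An extended $\mathbf{q}$-tableau is a weakly increasing $U:[1,\#\mathbf{q}]\to\mathbb{Z}_{\ge0}\cup\{\infty\}$ such that whenever $U(m)<\infty$, $((\mathbf{q}_1,\dots,\mathbf{q}_m),U|_{[1,m]})$ is a $(G,b,\ell)$-tableau; $\operatorname{Tab}^{\mathbf{q},\infty}_{G,b,\ell}$ is their set, a lattice under $U\preceq^\infty U'$ iff $U(i)\ge U'(i)$ for all $i$, with join the pointwise minimum. $g^{\mathbf{q}}$ sends $(\mathbf{p},L)$ to the function equal to $L$ on $[1,\#\mathbf{p}]$ and $\infty$ on $[\#\mathbf{p}+1,\#\mathbf{q}]$. An element $u$ of a lattice is join-irreducible if it is not the least element and $u=v\vee w$ implies $u\in\{v,w\}$. -}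

module Defs where

open import Data.Nat using (ℕ; zero; suc; _+_; _∸_; _≤_; _<_; _≤?_)
open import Data.Fin using (Fin)
open import Data.Product using (Σ; ∃; _×_; _,_)
open import Data.Sum using (_⊎_)
open import Relation.Nullary using (¬_; yes; no)
open import Relation.Binary.PropositionalEquality using (_≡_; _≢_)

record SimpleGraph (n : ℕ) : Set₁ where
  field
    Adj     : Fin n → Fin n → Set
    sym     : ∀ {u v} → Adj u v → Adj v u
    irrefl  : ∀ {u} → ¬ Adj u u
open SimpleGraph public

module _ {n : ℕ} (G : SimpleGraph n) where

  -- A G-path of length k with vertex sequence v 0, v 1, ..., v k
  -- (values of v beyond index k are irrelevant).
  IsPath : ℕ → (ℕ → Fin n) → Set
  IsPath k v = ∀ i → i < k → Adj G (v i) (v (suc i))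

  Connected : Set
  Connected = ∀ (x y : Fin n) →
    Σ ℕ λ k → Σ (ℕ → Fin n) λ v → IsPath k v × v 0 ≡ x × v k ≡ y

record GPath {n : ℕ} (G : SimpleGraph n) : Set where
  constructor mkPath
  field
    len  : ℕ
    vtx  : ℕ → Fin n
    path : IsPath G len vtx
open GPath public

module _ {n : ℕ} {G : SimpleGraph n} where

  _⪯pre_ : GPath G → GPath G → Set
  p ⪯pre q = len p ≤ len q × (∀ i → i ≤ len p → vtx p i ≡ vtx q i)

  CycleFree : (ℕ → Fin n) → ℕ → ℕ → Set
  CycleFree v j m = ∀ i i' → j ≤ i → i < i' → i' ≤ m → v i ≢ v i'

  -- The factorisation p = p⁽¹⁾ ⋯ p⁽ᴺ⁾ given by cut points
  -- 0 = c 0 < c 1 < ... < c N = #p, block t consisting of the edges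
  -- c (t-1) + 1, ..., c t, each block being the longest cycle-free
  -- suffix of p⁽¹⁾ ⋯ p⁽ᵗ⁾ (the path p_0 ... p_{c t}).
  IsFactorization : GPath G → ℕ → (ℕ → ℕ) → Set
  IsFactorization p N c =
      c 0 ≡ 0
    × c N ≡ len p
    × (∀ t → t < N → c t < c (suc t))
    × (∀ t → t < N → CycleFree (vtx p) (c t) (c (suc t)))
    × (∀ t → t < N → ∀ j → j < c t → ¬ CycleFree (vtx p) j (c (suc t)))

  -- (p , L) is a (G,b,ℓ)-tableau (L : [1,#p] → ℤ≥0 given as ℕ → ℕ,
  -- only values on [1,#p] matter)
  IsTableau : Fin n → ℕ → GPath G → (ℕ → ℕ) → Set
  IsTableau b ℓ p L =
      vtx p 0 ≡ b
    × (∀ i j → 1 ≤ i → i ≤ j → j ≤ len p → L i ≤ L j)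
    × (∀ i j → 1 ≤ i → i < j → j ≤ len p →
         vtx p (i ∸ 1) ≡ vtx p j → L i < L j)
    × (1 ≤ len p → L (len p) + len p ≤ ℓ)

  InTabPre : Fin n → ℕ → GPath G → GPath G → (ℕ → ℕ) → Set
  InTabPre b ℓ q p L = p ⪯pre q × IsTableau b ℓ p L

  -- tight tableau: L = L_{⟨p,a⟩} on [1,#p], where
  -- L_{⟨p,a⟩}(r) = d_p(r) + a - 1, with #p > 0 and
  -- 0 ≤ a ≤ ℓ + 1 - #p - n_p.  (r lies in block t+1 iff c t < r ≤ c (t+1).)
  Tight : Fin n → ℕ → GPath G → (ℕ → ℕ) → Set
  Tight b ℓ p L =
    IsTableau b ℓ p L × 1 ≤ len p ×
    Σ ℕ λ N → Σ (ℕ → ℕ) λ c → IsFactorization p N c ×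
      Σ ℕ λ a → a + len p + N ≤ ℓ + 1 ×
        (∀ t → t < N → ∀ r → c t < r → r ≤ c (suc t) →
           L r ≡ suc t + a ∸ 1)

data ℕ∞ : Set where
  fin : ℕ → ℕ∞
  ∞   : ℕ∞

data _≤∞_ : ℕ∞ → ℕ∞ → Set where
  fin≤fin : ∀ {a b} → a ≤ b → fin a ≤∞ fin b
  x≤∞     : ∀ {x} → x ≤∞ ∞

min∞ : ℕ∞ → ℕ∞ → ℕ∞
min∞ (fin a) (fin b) with a ≤? b
... | yes _ = fin a
... | no  _ = fin b
min∞ (fin a) ∞ = fin a
min∞ ∞ y = y

module _ {n : ℕ} {G : SimpleGraph n} where

  restrict : (q : GPath G) (m : ℕ) → m ≤ len q → GPath G
  restrict q m m≤ = mkPath m (vtx q) (λ i i<m → path q i (Data.Nat.Properties.<-≤-trans i<m m≤))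
    where import Data.Nat.Properties

  IsExtTab : Fin n → ℕ → GPath G → (ℕ → ℕ∞) → Set
  IsExtTab b ℓ q U =
      (∀ i j → 1 ≤ i → i ≤ j → j ≤ len q → U i ≤∞ U j)
    × (∀ m → 1 ≤ m → (m≤ : m ≤ len q) → ∀ k → U m ≡ fin k →
         Σ (ℕ → ℕ) λ L → (∀ i → 1 ≤ i → i ≤ m → U i ≡ fin (L i))
                        × IsTableau b ℓ (restrict q m m≤) L)

  _≈[_]_ : (ℕ → ℕ∞) → GPath G → (ℕ → ℕ∞) → Set
  U ≈[ q ] U' = ∀ i → 1 ≤ i → i ≤ len q → U i ≡ U' i

  _⪯∞[_]_ : (ℕ → ℕ∞) → GPath G → (ℕ → ℕ∞) → Set
  U ⪯∞[ q ] U' = ∀ i → 1 ≤ i → i ≤ len q → U' i ≤∞ U i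

  _∨∞_ : (ℕ → ℕ∞) → (ℕ → ℕ∞) → (ℕ → ℕ∞)
  (U ∨∞ U') i = min∞ (U i) (U' i)

  JoinIrreducible : Fin n → ℕ → GPath G → (ℕ → ℕ∞) → Set
  JoinIrreducible b ℓ q U =
      ¬ (∀ U' → IsExtTab b ℓ q U' → U ⪯∞[ q ] U')
    × (∀ V W → IsExtTab b ℓ q V → IsExtTab b ℓ q W →
         U ≈[ q ] (V ∨∞ W) → U ≈[ q ] V ⊎ U ≈[ q ] W)

  gq : GPath G → GPath G → (ℕ → ℕ) → (ℕ → ℕ∞)
  gq q p L i with i ≤? len p
  ... | yes _ = fin (L i)
  ... | no  _ = ∞

{-# OPTIONS --safe #-}
-- Any extended tableau V below g^q(p , L) that agrees with it at #p restricts
-- to a tableau L' ≥ L on p. When (p , L) is tight, the maximality of each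
-- block of the factorisation makes condition (ii) force L' to increase at every
-- block boundary, so L' ≤ L and V = g^q(p , L); in a splitting V ∨ W one of V, W
-- attains the value at #p. Conversely, a join-irreducible g^q(p , L) is not the
-- join of its truncation before the last edge with the tableau obtained by
-- raising L at a jump r by one; so that raise must violate (ii), i.e. p_{r-1}
-- recurs later with label L r + 1. Hence L increases by at most one per edge,
-- and cutting p where L increases gives the factorisation witnessing tightness
-- with a = L 1.
module Submission where

open import Defs hiding (sym)
open import Data.Nat
  using ( ℕ; zero; suc; _+_; _∸_; _≤_; _<_; _≤?_; _<?_; _≟_; z≤n; s≤s; z<s
        ; _≤′_; ≤′-refl; ≤′-step)
open import Data.Nat.Properties
open import Data.Fin using (Fin)
open import Data.Product using (Σ; _×_; _,_; proj₁; proj₂)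
open import Data.Sum using (_⊎_; inj₁; inj₂; [_,_]′)
open import Data.Empty using (⊥-elim)
open import Function.Base using (_∘_)
open import Function.Bundles using (_⇔_; mk⇔; Equivalence)
open import Relation.Binary.Definitions using (tri<; tri≈; tri>)
open import Relation.Nullary using (¬_; yes; no)
open import Relation.Binary.PropositionalEquality
  using (_≡_; _≢_; refl; sym; trans; cong; cong₂; subst; subst₂; module ≡-Reasoning)

open Equivalence using (to; from)

suc[n∸1]≡n : ∀ {n} → 1 ≤ n → suc (n ∸ 1) ≡ n
suc[n∸1]≡n (s≤s _) = refl

fin-injective : ∀ {a c} → fin a ≡ fin c → a ≡ c
fin-injective refl = refl

fin≢∞ : ∀ {a} → fin a ≢ ∞
fin≢∞ ()

fin≤∞fin⁻¹ : ∀ {a c} → fin a ≤∞ fin c → a ≤ c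
fin≤∞fin⁻¹ (fin≤fin a≤c) = a≤c

∞≤∞⇒≡∞ : ∀ {x} → ∞ ≤∞ x → x ≡ ∞
∞≤∞⇒≡∞ x≤∞ = refl

min∞-≤ˡ : ∀ x y → min∞ x y ≤∞ x
min∞-≤ˡ (fin a) (fin c) with a ≤? c
... | yes _   = fin≤fin ≤-refl
... | no a≰c = fin≤fin (≰⇒≥ a≰c)
min∞-≤ˡ (fin a) ∞ = fin≤fin ≤-refl
min∞-≤ˡ ∞ y = x≤∞

min∞-≤ʳ : ∀ x y → min∞ x y ≤∞ y
min∞-≤ʳ (fin a) (fin c) with a ≤? c
... | yes a≤c = fin≤fin a≤c
... | no _    = fin≤fin ≤-refl
min∞-≤ʳ (fin a) ∞ = x≤∞
min∞-≤ʳ ∞ (fin c) = fin≤fin ≤-refl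
min∞-≤ʳ ∞ ∞ = x≤∞

min∞-sel : ∀ x y → min∞ x y ≡ x ⊎ min∞ x y ≡ y
min∞-sel (fin a) (fin c) with a ≤? c
... | yes _ = inj₁ refl
... | no _  = inj₂ refl
min∞-sel (fin a) ∞ = inj₁ refl
min∞-sel ∞ y = inj₂ refl

min∞-fin-≤ : ∀ {a c} → a ≤ c → min∞ (fin a) (fin c) ≡ fin a
min∞-fin-≤ {a} {c} a≤c with a ≤? c
... | yes _  = refl
... | no a≰c = ⊥-elim (a≰c a≤c)

module _ {n : ℕ} {G : SimpleGraph n} where

  gq-≤ : ∀ (q p : GPath G) L {i} → i ≤ len p → gq q p L i ≡ fin (L i)
  gq-≤ q p L {i} i≤ with i ≤? len p
  ... | yes _  = refl
  ... | no i≰ = ⊥-elim (i≰ i≤)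

  gq-≰ : ∀ (q p : GPath G) L {i} → ¬ i ≤ len p → gq q p L i ≡ ∞
  gq-≰ q p L {i} i≰ with i ≤? len p
  ... | yes i≤ = ⊥-elim (i≰ i≤)
  ... | no _   = refl

  ⪯pre-refl : (p : GPath G) → p ⪯pre p
  ⪯pre-refl p = ≤-refl , λ _ _ → refl

  ⪯pre-trans : ∀ {p p' p'' : GPath G} → p ⪯pre p' → p' ⪯pre p'' → p ⪯pre p''
  ⪯pre-trans (len≤ , vtx≡) (len≤' , vtx≡') =
    ≤-trans len≤ len≤' , λ i i≤ → trans (vtx≡ i i≤) (vtx≡' i (≤-trans i≤ len≤))

  restrict-⪯pre : ∀ {p q : GPath G} → p ⪯pre q →
                  ∀ {k} (k≤p : k ≤ len p) (k≤q : k ≤ len q) → restrict q k k≤q ⪯pre p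
  restrict-⪯pre (_ , vtx≡) k≤p _ = k≤p , λ i i≤k → sym (vtx≡ i (≤-trans i≤k k≤p))

  ⪯pre-restrict : ∀ {p q : GPath G} (pq : p ⪯pre q) → p ⪯pre restrict q (len p) (proj₁ pq)
  ⪯pre-restrict (_ , vtx≡) = ≤-refl , vtx≡

  dropLast : GPath G → GPath G
  dropLast p = restrict p (len p ∸ 1) (m∸n≤m (len p) 1)

  dropLast-⪯pre : (p : GPath G) → dropLast p ⪯pre p
  dropLast-⪯pre p = restrict-⪯pre {p} {p} (⪯pre-refl p) (m∸n≤m (len p) 1) (m∸n≤m (len p) 1)

  adjacent-≢ : ∀ (p : GPath G) {i} → i < len p → vtx p i ≢ vtx p (suc i)
  adjacent-≢ p {i} i< v≡ = irrefl G (subst (Adj G (vtx p i)) (sym v≡) (path p i i<))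

  IsTableau-⪯pre : ∀ {b ℓ} {p p' : GPath G} {L} →
                   p ⪯pre p' → IsTableau b ℓ p' L → IsTableau b ℓ p L
  IsTableau-⪯pre {p = p} {p'} (len≤ , vtx≡) (p'₀ , mono , strict , top) =
    trans (vtx≡ 0 z≤n) p'₀ ,
    (λ i j 1≤i i≤j j≤ → mono i j 1≤i i≤j (≤-trans j≤ len≤)) ,
    (λ i j 1≤i i<j j≤ v≡ → strict i j 1≤i i<j (≤-trans j≤ len≤)
       (trans (sym (vtx≡ (i ∸ 1) (≤-trans (m∸n≤m i 1) (≤-trans (<⇒≤ i<j) j≤))))
              (trans v≡ (vtx≡ j j≤)))) ,
    λ 1≤len → ≤-trans (+-mono-≤ (mono (len p) (len p') 1≤len len≤ ≤-refl) len≤)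
                      (top (≤-trans 1≤len len≤))

  gq-IsExtTab : ∀ {b ℓ} {q p : GPath G} {L} → p ⪯pre q → IsTableau b ℓ p L →
                IsExtTab b ℓ q (gq q p L)
  gq-IsExtTab {q = q} {p} {L} pq tab@(_ , mono , _) = monotone , restrictions
    where
    monotone : ∀ i j → 1 ≤ i → i ≤ j → j ≤ len q → gq q p L i ≤∞ gq q p L j
    monotone i j 1≤i i≤j _ with j ≤? len p
    ... | no _    = x≤∞
    ... | yes j≤ = subst (_≤∞ fin (L j)) (sym (gq-≤ q p L (≤-trans i≤j j≤)))
                         (fin≤fin (mono i j 1≤i i≤j j≤))
    restrictions : ∀ k → 1 ≤ k → (k≤ : k ≤ len q) → ∀ u → gq q p L k ≡ fin u →
      Σ (ℕ → ℕ) λ L' → (∀ i → 1 ≤ i → i ≤ k → gq q p L i ≡ fin (L' i))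
                      × IsTableau _ _ (restrict q k k≤) L'
    restrictions k _ k≤ u e with k ≤? len p
    ... | no _    = ⊥-elim (fin≢∞ (sym e))
    ... | yes k≤p = L , (λ i _ i≤k → gq-≤ q p L (≤-trans i≤k k≤p)) ,
                    IsTableau-⪯pre {p = restrict q k k≤} {p' = p}
                                   (restrict-⪯pre {p} {q} pq k≤p k≤) tab

  ∞-IsExtTab : ∀ {b ℓ} (q : GPath G) → IsExtTab b ℓ q (λ _ → ∞)
  ∞-IsExtTab _ = (λ _ _ _ _ _ → x≤∞) , λ _ _ _ _ ()

  ≈∨∞⇒⪯∞ˡ : ∀ {q : GPath G} {U V W} → U ≈[ q ] (_∨∞_ {G = G} V W) → V ⪯∞[ q ] U
  ≈∨∞⇒⪯∞ˡ {V = V} {W} U≈ i 1≤i i≤ =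
    subst (_≤∞ V i) (sym (U≈ i 1≤i i≤)) (min∞-≤ˡ (V i) (W i))

  ≈∨∞⇒⪯∞ʳ : ∀ {q : GPath G} {U V W} → U ≈[ q ] (_∨∞_ {G = G} V W) → W ⪯∞[ q ] U
  ≈∨∞⇒⪯∞ʳ {V = V} {W} U≈ i 1≤i i≤ =
    subst (_≤∞ W i) (sym (U≈ i 1≤i i≤)) (min∞-≤ʳ (V i) (W i))

CycleFree-extendˡ : ∀ {n} {G : SimpleGraph n} {v : ℕ → Fin n} {j k} →
  CycleFree {G = G} v (suc j) k → (∀ i' → j < i' → i' ≤ k → v j ≢ v i') →
  CycleFree {G = G} v j k
CycleFree-extendˡ cycleFree fresh i i' j≤i i<i' i'≤k with m≤n⇒m<n∨m≡n j≤i
... | inj₁ j<i  = cycleFree i i' j<i i<i' i'≤k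
... | inj₂ refl = fresh i' i<i' i'≤k

locate : ∀ (c : ℕ → ℕ) N {r} → c 0 < r → r ≤ c N →
         Σ ℕ λ t → t < N × c t < r × r ≤ c (suc t)
locate c zero c0<r r≤c0 = ⊥-elim (<⇒≱ c0<r r≤c0)
locate c (suc N) {r} c0<r r≤ with r ≤? c N
... | yes r≤cN = let (t , t<N , ct<r , r≤ct') = locate c N c0<r r≤cN
                 in t , m<n⇒m<1+n t<N , ct<r , r≤ct'
... | no r≰cN  = N , ≤-refl , ≰⇒> r≰cN , r≤

module _ {n : ℕ} {G : SimpleGraph n} {p : GPath G} {N : ℕ} {c : ℕ → ℕ}
         (fac : IsFactorization p N c) where

  private
    c-inc : ∀ t → t < N → c t < c (suc t)
    c-inc = proj₁ (proj₂ (proj₂ fac))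

  cut-mono : ∀ {s s'} → s ≤′ s' → s' ≤ N → c s ≤ c s'
  cut-mono ≤′-refl _ = ≤-refl
  cut-mono (≤′-step s≤s') s'<N =
    ≤-trans (cut-mono s≤s' (<⇒≤ s'<N)) (<⇒≤ (c-inc _ s'<N))

  cut-≤len : ∀ {s} → s ≤ N → c s ≤ len p
  cut-≤len s≤N = subst (_ ≤_) (proj₁ (proj₂ fac)) (cut-mono (≤⇒≤′ s≤N) ≤-refl)

  cut-≥ : ∀ {s} → s ≤ N → s ≤ c s
  cut-≥ {zero} _ = z≤n
  cut-≥ {suc s} s<N = ≤-<-trans (cut-≥ (<⇒≤ s<N)) (c-inc s s<N)

  -- A later repetition of the vertex just before block s + 1 is what stops the
  -- block from extending leftwards; condition (ii) turns it into a strict increase.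
  boundary-< : ∀ {b ℓ L s} → IsTableau b ℓ p L → 1 ≤ s → s < N → L (c s) < L (c (suc s))
  boundary-< {L = L} {s} (_ , mono , strict , _) 1≤s s<N with L (c s) <? L (c (suc s))
  ... | yes increase = increase
  ... | no ≮ = ⊥-elim (maximal s s<N (c s ∸ 1) (∸-monoʳ-< z<s 1≤cs) extended)
    where
    maximal : ∀ t → t < N → ∀ j → j < c t → ¬ CycleFree {G = G} (vtx p) j (c (suc t))
    maximal = proj₂ (proj₂ (proj₂ (proj₂ fac)))
    1≤cs : 1 ≤ c s
    1≤cs = ≤-trans 1≤s (cut-≥ (<⇒≤ s<N))
    end≤ : c (suc s) ≤ len p
    end≤ = cut-≤len s<N
    fresh : ∀ i' → c s ∸ 1 < i' → i' ≤ c (suc s) → vtx p (c s ∸ 1) ≢ vtx p i'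
    fresh i' cs∸1<i' i'≤ v≡ with m≤n⇒m<n∨m≡n (subst (_≤ i') (suc[n∸1]≡n 1≤cs) cs∸1<i')
    ... | inj₁ cs<i' = ≮ (<-≤-trans (strict (c s) i' 1≤cs cs<i' (≤-trans i'≤ end≤) v≡)
                                     (mono i' (c (suc s)) (≤-trans 1≤cs (<⇒≤ cs<i')) i'≤ end≤))
    ... | inj₂ cs≡i' = adjacent-≢ p
                         (subst (_≤ len p) (sym (suc[n∸1]≡n 1≤cs)) (cut-≤len (<⇒≤ s<N)))
                         (trans v≡ (cong (vtx p) (sym (trans (suc[n∸1]≡n 1≤cs) cs≡i'))))
    extended : CycleFree {G = G} (vtx p) (c s ∸ 1) (c (suc s))
    extended = CycleFree-extendˡ {G = G}
      (subst (λ j → CycleFree {G = G} (vtx p) j (c (suc s))) (sym (suc[n∸1]≡n 1≤cs))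
             (proj₁ (proj₂ (proj₂ (proj₂ fac))) s s<N))
      fresh

module _ {n : ℕ} {G : SimpleGraph n} {b : Fin n} {ℓ : ℕ} where

  -- Going down from the last block, L' drops by at least one at every block
  -- boundary, while the tight L drops by exactly one.
  tight-dominates : ∀ {p : GPath G} {L L'} → Tight b ℓ p L → IsTableau b ℓ p L' →
    L' (len p) ≤ L (len p) → ∀ i → 1 ≤ i → i ≤ len p → L' i ≤ L i
  tight-dominates (_ , 1≤len , zero , c , (c0 , cN , _) , _) _ _ _ _ _ =
    ⊥-elim (<⇒≱ 1≤len (≤-reflexive (trans (sym cN) c0)))
  tight-dominates {p} {L} {L'} (_ , _ , suc N , c , fac@(c0 , cN , c-inc , _) , a , _ , labels)
                  tab'@(_ , mono' , _) L'end≤ i 1≤i i≤len =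
    let (t , t<N , ct<i , i≤ct') = locate c (suc N) (subst (_< i) (sym c0) 1≤i)
                                                    (subst (i ≤_) (sym cN) i≤len)
    in begin
      L' i            ≤⟨ mono' i (c (suc t)) 1≤i i≤ct' (cut-≤len {p = p} fac t<N) ⟩
      L' (c (suc t))  ≤⟨ block-end-≤ (N ∸ t) t (m+[n∸m]≡n (≤-pred t<N)) ⟩
      t + a           ≡⟨ sym (labels t t<N i ct<i i≤ct') ⟩
      L i             ∎
    where
    open ≤-Reasoning
    L-end : L (len p) ≡ N + a
    L-end = labels N ≤-refl (len p) (subst (c N <_) cN (c-inc N ≤-refl)) (≤-reflexive (sym cN))
    block-end-≤ : ∀ d t → t + d ≡ N → L' (c (suc t)) ≤ t + a
    block-end-≤ zero t t+0≡N =
      subst (λ s → L' (c (suc s)) ≤ s + a) (trans (sym t+0≡N) (+-identityʳ t)) (begin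
        L' (c (suc N))  ≡⟨ cong L' cN ⟩
        L' (len p)      ≤⟨ L'end≤ ⟩
        L (len p)       ≡⟨ L-end ⟩
        N + a           ∎)
    block-end-≤ (suc d) t t+d+1≡N =
      ≤-pred (<-≤-trans (boundary-< {p = p} fac tab' (s≤s z≤n) st<N) (block-end-≤ d (suc t) st+d≡N))
      where
      st+d≡N : suc t + d ≡ N
      st+d≡N = trans (sym (+-suc t d)) t+d+1≡N
      st<N : suc t < suc N
      st<N = s≤s (subst (suc t ≤_) st+d≡N (m≤m+n (suc t) d))

  tight-unique-below : ∀ {q p : GPath G} {L V} → p ⪯pre q → Tight b ℓ p L → IsExtTab b ℓ q V →
    V ⪯∞[ q ] gq q p L → V (len p) ≡ fin (L (len p)) → gq q p L ≈[ q ] V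
  tight-unique-below {q} {p} {L} {V} pq tight@(_ , 1≤len , _) (_ , restrictions) V⪯ V-end i 1≤i i≤q
    with i ≤? len p
  ... | no i≰  = sym (∞≤∞⇒≡∞ (subst (_≤∞ V i) (gq-≰ q p L i≰) (V⪯ i 1≤i i≤q)))
  ... | yes i≤ = trans (cong fin (≤-antisym lower upper)) (sym (V≡ i 1≤i i≤))
    where
    restriction : Σ (ℕ → ℕ) λ L' → (∀ i → 1 ≤ i → i ≤ len p → V i ≡ fin (L' i))
                                  × IsTableau b ℓ (restrict q (len p) (proj₁ pq)) L'
    restriction = restrictions (len p) 1≤len (proj₁ pq) (L (len p)) V-end
    LV : ℕ → ℕ
    LV = proj₁ restriction
    V≡ : ∀ i → 1 ≤ i → i ≤ len p → V i ≡ fin (LV i)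
    V≡ = proj₁ (proj₂ restriction)
    LV-end : LV (len p) ≤ L (len p)
    LV-end = ≤-reflexive (fin-injective (trans (sym (V≡ (len p) 1≤len ≤-refl)) V-end))
    lower : L i ≤ LV i
    lower = fin≤∞fin⁻¹ (subst₂ _≤∞_ (gq-≤ q p L i≤) (V≡ i 1≤i i≤) (V⪯ i 1≤i i≤q))
    upper : LV i ≤ L i
    upper = tight-dominates {p = p} {L} {LV} tight
              (IsTableau-⪯pre {p = p} {p' = restrict q (len p) (proj₁ pq)}
                              (⪯pre-restrict {p = p} {q = q} pq) (proj₂ (proj₂ restriction)))
              LV-end i 1≤i i≤

  tight⇒joinIrreducible : ∀ {q p : GPath G} {L} → p ⪯pre q → Tight b ℓ p L →
                          JoinIrreducible b ℓ q (gq q p L)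
  tight⇒joinIrreducible {q} {p} {L} pq tight@(_ , 1≤len , _) = notLeast , split
    where
    len≤q : len p ≤ len q
    len≤q = proj₁ pq
    notLeast : ¬ (∀ U' → IsExtTab b ℓ q U' → gq q p L ⪯∞[ q ] U')
    notLeast least = fin≢∞ (trans (sym (gq-≤ q p L 1≤len))
      (∞≤∞⇒≡∞ (least (λ _ → ∞) (∞-IsExtTab q) 1 ≤-refl (≤-trans 1≤len len≤q))))
    split : ∀ V W → IsExtTab b ℓ q V → IsExtTab b ℓ q W →
            gq q p L ≈[ q ] (_∨∞_ {G = G} V W) → gq q p L ≈[ q ] V ⊎ gq q p L ≈[ q ] W
    split V W extV extW U≈ =
      [ (λ min≡V → inj₁ (tight-unique-below {q} {p} {L} {V} pq tight extV
                           (≈∨∞⇒⪯∞ˡ {q = q} {V = V} {W} U≈) (trans (sym min≡V) U-end)))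
      , (λ min≡W → inj₂ (tight-unique-below {q} {p} {L} {W} pq tight extW
                           (≈∨∞⇒⪯∞ʳ {q = q} {V = V} {W} U≈) (trans (sym min≡W) U-end)))
      ]′ (min∞-sel (V (len p)) (W (len p)))
      where
      U-end : min∞ (V (len p)) (W (len p)) ≡ fin (L (len p))
      U-end = trans (sym (U≈ (len p) 1≤len len≤q)) (gq-≤ q p L ≤-refl)

MonotoneOn : ℕ → (ℕ → ℕ) → Set
MonotoneOn k f = ∀ i j → 1 ≤ i → i ≤ j → j ≤ k → f i ≤ f j

lastBelow : (ℕ → ℕ) → ℕ → ℕ → ℕ
lastBelow f x zero = zero
lastBelow f x (suc k) with f (suc k) <? x
... | yes _ = suc k
... | no _  = lastBelow f x k

lastBelow-≤ : ∀ f x k → lastBelow f x k ≤ k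
lastBelow-≤ f x zero = z≤n
lastBelow-≤ f x (suc k) with f (suc k) <? x
... | yes _ = ≤-refl
... | no _  = m≤n⇒m≤1+n (lastBelow-≤ f x k)

lastBelow-spec : ∀ {f k} x → MonotoneOn k f →
                 ∀ {r} → 1 ≤ r → r ≤ k → (r ≤ lastBelow f x k ⇔ f r < x)
lastBelow-spec {k = zero} x _ 1≤r r≤0 = ⊥-elim (<⇒≱ 1≤r r≤0)
lastBelow-spec {f} {suc k} x mono {r} 1≤r r≤ with f (suc k) <? x
... | yes below = mk⇔ (λ _ → ≤-<-trans (mono r (suc k) 1≤r r≤ ≤-refl) below) (λ _ → r≤)
... | no ≮x with m≤n⇒m<n∨m≡n r≤
...   | inj₂ refl = mk⇔ (λ r≤lb → ⊥-elim (<⇒≱ (s≤s (lastBelow-≤ f x k)) r≤lb))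
                        (λ below → ⊥-elim (≮x below))
...   | inj₁ r<   =
  lastBelow-spec x (λ i j 1≤i i≤j j≤k → mono i j 1≤i i≤j (m≤n⇒m≤1+n j≤k)) 1≤r (≤-pred r<)

raise : ℕ → (ℕ → ℕ) → ℕ → ℕ
raise r L i with i ≟ r
... | yes _ = suc (L r)
... | no _  = L i

raise-≡ : ∀ r L → raise r L r ≡ suc (L r)
raise-≡ r L with r ≟ r
... | yes _  = refl
... | no r≢r = ⊥-elim (r≢r refl)

raise-≢ : ∀ {r i} L → i ≢ r → raise r L i ≡ L i
raise-≢ {r} {i} L i≢r with i ≟ r
... | yes i≡r = ⊥-elim (i≢r i≡r)
... | no _    = refl

raise-≥ : ∀ r L i → L i ≤ raise r L i
raise-≥ r L i with i ≟ r
... | yes refl = n≤1+n (L i)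
... | no _     = ≤-refl

module _ {n : ℕ} {G : SimpleGraph n} {b : Fin n} {ℓ : ℕ} where

  RaiseBlocked : GPath G → (ℕ → ℕ) → ℕ → Set
  RaiseBlocked p L r = Σ ℕ λ j → r < j × j ≤ len p × vtx p (r ∸ 1) ≡ vtx p j × L j ≡ suc (L r)

  raise-IsTableau : ∀ {p : GPath G} {L r} → IsTableau b ℓ p L → suc r ≤ len p →
    L r < L (suc r) → ¬ RaiseBlocked p L r → IsTableau b ℓ p (raise r L)
  raise-IsTableau {p} {L} {r} (p₀ , mono , strict , top) r<len jump unblocked =
    p₀ , mono' , strict' ,
    λ 1≤len → subst (λ x → x + len p ≤ ℓ) (sym (raise-≢ L (<⇒≢ r<len ∘ sym))) (top 1≤len)
    where
    mono' : ∀ i j → 1 ≤ i → i ≤ j → j ≤ len p → raise r L i ≤ raise r L j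
    mono' i j 1≤i i≤j j≤ with i ≟ r | j ≟ r
    ... | yes refl | yes refl = ≤-refl
    ... | yes refl | no j≢r   =
      ≤-trans jump (mono (suc r) j (s≤s z≤n) (≤∧≢⇒< i≤j (j≢r ∘ sym)) j≤)
    ... | no _     | yes refl = m≤n⇒m≤1+n (mono i r 1≤i i≤j j≤)
    ... | no _     | no _     = mono i j 1≤i i≤j j≤
    strict' : ∀ i j → 1 ≤ i → i < j → j ≤ len p → vtx p (i ∸ 1) ≡ vtx p j →
              raise r L i < raise r L j
    strict' i j 1≤i i<j j≤ v≡ with i ≟ r | j ≟ r
    ... | yes refl | yes refl = ⊥-elim (<-irrefl refl i<j)
    ... | yes refl | no _     = ≤∧≢⇒< (strict i j 1≤i i<j j≤ v≡)
                                       (λ Lj≡ → unblocked (j , i<j , j≤ , v≡ , sym Lj≡))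
    ... | no _     | yes refl = m≤n⇒m≤1+n (strict i j 1≤i i<j j≤ v≡)
    ... | no _     | no _     = strict i j 1≤i i<j j≤ v≡

  gq-≈-∨∞ : ∀ (q p : GPath G) L L' → 1 ≤ len p → (∀ i → L i ≤ L' i) →
    L' (len p) ≡ L (len p) → gq q p L ≈[ q ] (_∨∞_ {G = G} (gq q (dropLast p) L) (gq q p L'))
  gq-≈-∨∞ q p L L' 1≤len L≤L' end≡ i _ _ with <-cmp i (len p)
  ... | tri< i<len _ _ = begin
    gq q p L i
      ≡⟨ gq-≤ q p L (<⇒≤ i<len) ⟩
    fin (L i)
      ≡⟨ min∞-fin-≤ (L≤L' i) ⟨
    min∞ (fin (L i)) (fin (L' i))
      ≡⟨ cong₂ min∞ (gq-≤ q (dropLast p) L (∸-monoˡ-≤ 1 i<len)) (gq-≤ q p L' (<⇒≤ i<len)) ⟨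
    min∞ (gq q (dropLast p) L i) (gq q p L' i) ∎
    where open ≡-Reasoning
  ... | tri≈ _ refl _ = begin
    gq q p L i
      ≡⟨ gq-≤ q p L ≤-refl ⟩
    fin (L i)
      ≡⟨ cong fin end≡ ⟨
    min∞ ∞ (fin (L' i))
      ≡⟨ cong₂ min∞ (gq-≰ q (dropLast p) L (<⇒≱ (∸-monoʳ-< z<s 1≤len))) (gq-≤ q p L' ≤-refl) ⟨
    min∞ (gq q (dropLast p) L i) (gq q p L' i) ∎
    where open ≡-Reasoning
  ... | tri> _ _ len<i = begin
    gq q p L i
      ≡⟨ gq-≰ q p L (<⇒≱ len<i) ⟩
    min∞ ∞ ∞
      ≡⟨ cong₂ min∞ (gq-≰ q (dropLast p) L (<⇒≱ (≤-<-trans (m∸n≤m _ 1) len<i)))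
                    (gq-≰ q p L' (<⇒≱ len<i)) ⟨
    min∞ (gq q (dropLast p) L i) (gq q p L' i) ∎
    where open ≡-Reasoning

  module _ {q p : GPath G} {L : ℕ → ℕ} (pq : p ⪯pre q) (tab : IsTableau b ℓ p L)
           (ji : JoinIrreducible b ℓ q (gq q p L)) where

    private
      mono : MonotoneOn (len p) L
      mono = proj₁ (proj₂ tab)

      strict : ∀ i j → 1 ≤ i → i < j → j ≤ len p → vtx p (i ∸ 1) ≡ vtx p j → L i < L j
      strict = proj₁ (proj₂ (proj₂ tab))

    -- Otherwise g^q(p , L) splits as the join of g^q(dropLast p , L) and g^q(p , raise r L).
    jump-blocked : ∀ {r} → 1 ≤ r → suc r ≤ len p → L r < L (suc r) → ¬ ¬ RaiseBlocked p L r
    jump-blocked {r} 1≤r r<len jump unblocked =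
      [ truncation-differs , raise-differs ]′
        (proj₂ ji (gq q (dropLast p) L) (gq q p (raise r L))
           (gq-IsExtTab {q = q} {dropLast p}
              (⪯pre-trans {p = dropLast p} {p' = p} {p'' = q} (dropLast-⪯pre p) pq)
              (IsTableau-⪯pre {p = dropLast p} {p' = p} (dropLast-⪯pre p) tab))
           (gq-IsExtTab {q = q} {p} pq (raise-IsTableau {p} tab r<len jump unblocked))
           (gq-≈-∨∞ q p L (raise r L) 1≤len (raise-≥ r L) (raise-≢ L (<⇒≢ r<len ∘ sym))))
      where
      open ≡-Reasoning
      1≤len : 1 ≤ len p
      1≤len = ≤-trans (s≤s z≤n) r<len
      truncation-differs : ¬ gq q p L ≈[ q ] gq q (dropLast p) L
      truncation-differs U≈ = fin≢∞ (begin
        fin (L (len p))             ≡⟨ sym (gq-≤ q p L ≤-refl) ⟩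
        gq q p L (len p)            ≡⟨ U≈ (len p) 1≤len (proj₁ pq) ⟩
        gq q (dropLast p) L (len p) ≡⟨ gq-≰ q (dropLast p) L (<⇒≱ (∸-monoʳ-< z<s 1≤len)) ⟩
        ∞                           ∎)
      raise-differs : ¬ gq q p L ≈[ q ] gq q p (raise r L)
      raise-differs U≈ = 1+n≢n (sym (fin-injective (begin
        fin (L r)                   ≡⟨ sym (gq-≤ q p L (<⇒≤ r<len)) ⟩
        gq q p L r                  ≡⟨ U≈ r 1≤r (≤-trans (<⇒≤ r<len) (proj₁ pq)) ⟩
        gq q p (raise r L) r        ≡⟨ gq-≤ q p (raise r L) (<⇒≤ r<len) ⟩
        fin (raise r L r)           ≡⟨ cong fin (raise-≡ r L) ⟩
        fin (suc (L r))             ∎)))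

    jump-≤1 : ∀ {r} → 1 ≤ r → suc r ≤ len p → L (suc r) ≤ suc (L r)
    jump-≤1 {r} 1≤r r<len with L r <? L (suc r)
    ... | no ≮        = m≤n⇒m≤1+n (≮⇒≥ ≮)
    ... | yes jump with L (suc r) ≤? suc (L r)
    ...   | yes ≤1    = ≤1
    ...   | no tooBig = ⊥-elim (jump-blocked 1≤r r<len jump λ (j , r<j , j≤ , _ , Lj≡) →
                          tooBig (subst (L (suc r) ≤_) Lj≡ (mono (suc r) j (s≤s z≤n) r<j j≤)))

    nonempty : 1 ≤ len p
    nonempty with 1 ≤? len p
    ... | yes 1≤len = 1≤len
    ... | no 1≰len  = ⊥-elim (proj₁ ji λ U' _ i 1≤i _ →
                        subst (U' i ≤∞_) (sym (gq-≰ q p L (1≰len ∘ ≤-trans 1≤i))) x≤∞)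

    -- Block t + 1 consists of the edges labelled t + a; it ends at cut (t + 1).
    private
      a : ℕ
      a = L 1

      blocks : ℕ
      blocks = suc (L (len p) ∸ a)

      cut : ℕ → ℕ
      cut t = lastBelow L (t + a) (len p)

      cut-spec : ∀ t {r} → 1 ≤ r → r ≤ len p → (r ≤ cut t ⇔ L r < t + a)
      cut-spec t = lastBelow-spec (t + a) mono

      cut-≤ : ∀ t → cut t ≤ len p
      cut-≤ t = lastBelow-≤ L (t + a) (len p)

      a≤L : ∀ {r} → 1 ≤ r → r ≤ len p → a ≤ L r
      a≤L = mono 1 _ ≤-refl

    cut-zero : cut 0 ≡ 0
    cut-zero = n≤0⇒n≡0 (≮⇒≥ λ 1≤c →
      <⇒≱ (to (cut-spec 0 1≤c (cut-≤ 0)) ≤-refl) (a≤L 1≤c (cut-≤ 0)))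

    cut-end : cut blocks ≡ len p
    cut-end = ≤-antisym (cut-≤ blocks)
      (from (cut-spec blocks nonempty ≤-refl)
            (s≤s (≤-reflexive (sym (m∸n+n≡m (a≤L nonempty ≤-refl))))))

    block-label : ∀ t {r} → cut t < r → r ≤ cut (suc t) → L r ≡ t + a
    block-label t {r} ct<r r≤ = ≤-antisym
      (≤-pred (to (cut-spec (suc t) 1≤r r≤len) r≤))
      (≮⇒≥ λ below → <⇒≱ ct<r (from (cut-spec t 1≤r r≤len) below))
      where
      1≤r : 1 ≤ r
      1≤r = ≤-<-trans z≤n ct<r
      r≤len : r ≤ len p
      r≤len = ≤-trans r≤ (cut-≤ (suc t))

    cut-< : ∀ t → t < blocks → cut t < cut (suc t)
    cut-< t t<blocks = ≰⇒> λ end≤ct →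
      <⇒≱ (to (cut-spec t 1≤end (cut-≤ (suc t))) end≤ct) t+a≤L-end
      where
      end : ℕ
      end = cut (suc t)
      1≤end : 1 ≤ end
      1≤end = from (cut-spec (suc t) ≤-refl nonempty) (s≤s (m≤n+m a t))
      t+a≤L-end : t + a ≤ L end
      t+a≤L-end with m≤n⇒m<n∨m≡n (cut-≤ (suc t))
      ... | inj₂ end≡len = subst (λ r → t + a ≤ L r) (sym end≡len)
            (subst (t + a ≤_) (m∸n+n≡m (a≤L nonempty ≤-refl)) (+-monoˡ-≤ a (≤-pred t<blocks)))
      ... | inj₁ end<len = ≤-pred (≤-trans next-≥ (jump-≤1 1≤end end<len))
        where
        next-≥ : suc t + a ≤ L (suc end)
        next-≥ = ≮⇒≥ λ below → <-irrefl refl (from (cut-spec (suc t) (s≤s z≤n) end<len) below)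

    block-cycleFree : ∀ t → CycleFree {G = G} (vtx p) (cut t) (cut (suc t))
    block-cycleFree t i i' ct≤i i<i' i'≤ v≡ with m≤n⇒m<n∨m≡n i<i'
    ... | inj₂ refl   = adjacent-≢ p (≤-trans i'≤ (cut-≤ (suc t))) v≡
    ... | inj₁ si<i' = <-irrefl
            (trans (block-label t (s≤s ct≤i) (≤-trans (<⇒≤ si<i') i'≤))
                   (sym (block-label t (≤-<-trans ct≤i i<i') i'≤)))
            (strict (suc i) i' (s≤s z≤n) si<i' (≤-trans i'≤ (cut-≤ (suc t))) v≡)

    -- At r = cut t the labels jump, and the blocking repetition of the vertex
    -- p_{r-1} lies inside block t + 1.
    block-maximal : ∀ t → t < blocks → ∀ j → j < cut t →
                    ¬ CycleFree {G = G} (vtx p) j (cut (suc t))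
    block-maximal t t<blocks j j<r cycleFree = jump-blocked 1≤r r<len jump
      λ (j' , r<j' , j'≤ , v≡ , Lj'≡) →
        cycleFree (r ∸ 1) j' (∸-monoˡ-≤ 1 j<r) (≤-<-trans (m∸n≤m r 1) r<j')
          (from (cut-spec (suc t) (≤-trans (s≤s z≤n) r<j') j'≤)
                (subst (_< suc t + a) (sym Lj'≡) (s≤s Lr<)))
          v≡
      where
      r : ℕ
      r = cut t
      1≤r : 1 ≤ r
      1≤r = ≤-<-trans z≤n j<r
      r<len : suc r ≤ len p
      r<len = ≤-trans (cut-< t t<blocks) (cut-≤ (suc t))
      Lr< : L r < t + a
      Lr< = to (cut-spec t 1≤r (<⇒≤ r<len)) ≤-refl
      jump : L r < L (suc r)
      jump = <-≤-trans Lr< (≤-reflexive (sym (block-label t ≤-refl (cut-< t t<blocks))))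

    blocks-bound : a + len p + blocks ≤ ℓ + 1
    blocks-bound = begin
      a + len p + suc k       ≡⟨ +-suc (a + len p) k ⟩
      suc (a + len p + k)     ≡⟨ cong suc (trans (+-comm (a + len p) k) (sym (+-assoc k a (len p)))) ⟩
      suc (k + a + len p)     ≡⟨ cong (λ x → suc (x + len p)) (m∸n+n≡m (a≤L nonempty ≤-refl)) ⟩
      suc (L (len p) + len p) ≤⟨ s≤s (proj₂ (proj₂ (proj₂ tab)) nonempty) ⟩
      suc ℓ                   ≡⟨ +-comm 1 ℓ ⟩
      ℓ + 1                   ∎
      where
      open ≤-Reasoning
      k : ℕ
      k = L (len p) ∸ a

    joinIrreducible⇒tight : Tight b ℓ p L
    joinIrreducible⇒tight =
      tab , nonempty , blocks , cut ,
      (cut-zero , cut-end , cut-< , (λ t _ → block-cycleFree t) , block-maximal) ,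
      a , blocks-bound , λ t _ r → block-label t

lemma3p7 : ∀ {n : ℕ} (G : SimpleGraph n) → Connected G →
    (b : Fin n) (ℓ : ℕ) (q : GPath G) → vtx q 0 ≡ b →
    (p : GPath G) (L : ℕ → ℕ) → InTabPre b ℓ q p L →
    (Tight b ℓ p L → JoinIrreducible b ℓ q (gq q p L))
    × (JoinIrreducible b ℓ q (gq q p L) → Tight b ℓ p L)
lemma3p7 G _ b ℓ q _ p L (pq , tab) =
  tight⇒joinIrreducible {q = q} {p} {L} pq ,
  joinIrreducible⇒tight {q = q} {p} {L} pq tab
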